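{- Taking paths indexed by $(\mathbb{N},\mathcal{C}_{succ})$: there exist a closure model $\mathcal{M}$ and points $x_1,x_2$ of $\mathcal{M}$ that are Path-bisimilar but not trace equivalent; and there exist a closure model $\mathcal{M}$ and points $x_1,x_2$ of $\mathcal{M}$ that are trace equivalent but not Path-bisimilar.
   Context: A closure space is $(X,\mathcal{C})$, $X$ non-empty, with $\mathcal{C}(\emptyset)=\emptyset$, $A\subseteq\mathcal{C}(A)$, $\mathcal{C}(A_1\cup A_2)=\mathcal{C}(A_1)\cup\mathcal{C}(A_2)$. A closure model is $(X,\mathcal{C},\mathcal{V})$ with $\mathcal{V}:AP\to\mathcal{P}(X)$ for a fixed set $AP$; $\mathcal{V}^{ -1}(x)=\{p:x\in\mathcal{V}(p)\}$. Paths: $\mathcal{C}_{succ}(N')=N'\cup\{n+1:n\in N'\}$ for $N'\subseteq\mathbb{N}$; a path is $\pi:\mathbb{N}\to X$ with $\pi(\mathcal{C}_{succ}(N'))\subseteq\mathcal{C}(\pi(N'))$ for all $N'$; bounded if some $\ell$ has $\pi(i)=\pi(\ell)$ for all $i\ge\ell$, $\mathrm{len}(\pi)$ the least such $\ell$. $\mathrm{BPaths^F}(x)$: bounded paths with $\pi(0)=x$; $\mathrm{BPaths^T}(x)$: bounded paths with $\pi(\mathrm{len}(\pi))=x$. Trace: $\mathrm{Tr}(\pi)(i)=\mathcal{V}^{ -1}(\pi(i))$; $x_1,x_2$ are trace equivalent if $\{\mathrm{Tr}(\pi):\pi\in\mathrm{BPaths^F}(x_1)\}=\{\mathrm{Tr}(\pi):\pi\in\mathrm{BPaths^F}(x_2)\}$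 and likewise for $\mathrm{BPaths^T}$. Path-bisimulation: non-empty $B\subseteq X\times X$ such that whenever $(x_1,x_2)\in B$: (1) $\mathcal{V}^{ -1}(x_1)=\mathcal{V}^{ -1}(x_2)$; (2) for all $\pi_1\in\mathrm{BPaths^F}(x_1)$ there is $\pi_2\in\mathrm{BPaths^F}(x_2)$ with $(\pi_1(\mathrm{len}(\pi_1)),\pi_2(\mathrm{len}(\pi_2)))\in B$; (3) symmetrically from $x_2$; (4) for all $\pi_1\in\mathrm{BPaths^T}(x_1)$ there is $\pi_2\in\mathrm{BPaths^T}(x_2)$ with $(\pi_1(0),\pi_2(0))\in B$; (5) symmetrically. Path-bisimilar: contained in some Path-bisimulation. -}

module Defs where

open import Level using (0ℓ)
open import Data.Nat using (ℕ; zero; suc; _≤_)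
open import Data.Product using (Σ; ∃; _×_; _,_; proj₁; proj₂)
open import Data.Sum using (_⊎_)
open import Data.Empty using (⊥)
open import Relation.Binary.PropositionalEquality using (_≡_)

Subset : Set → Set₁
Subset X = X → Set

∅ : {X : Set} → Subset X
∅ _ = ⊥

_∪_ : {X : Set} → Subset X → Subset X → Subset X
(A ∪ B) x = A x ⊎ B x

_⊆_ : {X : Set} → Subset X → Subset X → Set
A ⊆ B = ∀ x → A x → B x

_≐_ : {X : Set} → Subset X → Subset X → Set
A ≐ B = (A ⊆ B) × (B ⊆ A)

image : {X Y : Set} → (X → Y) → Subset X → Subset Y
image f A y = Σ _ λ n → A n × f n ≡ y

record ClosureSpace : Set₁ where
  field
    Carrier   : Set
    inhabited : Carrier
    C         : Subset Carrier → Subset Carrier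
    C-∅       : C ∅ ≐ ∅
    C-ext     : ∀ A → A ⊆ C A
    C-∪       : ∀ A₁ A₂ → C (A₁ ∪ A₂) ≐ (C A₁ ∪ C A₂)

record ClosureModel (AP : Set) : Set₁ where
  field
    space : ClosureSpace
  open ClosureSpace space public
  field
    V : AP → Subset Carrier

  V⁻¹ : Carrier → Subset AP
  V⁻¹ x p = V p x

Csucc : Subset ℕ → Subset ℕ
Csucc N' m = N' m ⊎ Σ ℕ λ n → N' n × m ≡ suc n

module _ {AP : Set} (M : ClosureModel AP) where
  open ClosureModel M

  -- π is a path (continuous from (ℕ, Csucc) to (X, C)).
  IsPath : (ℕ → Carrier) → Set₁
  IsPath π = ∀ (N' : Subset ℕ) → image π (Csucc N') ⊆ C (image π N')

  StableFrom : (ℕ → Carrier) → ℕ → Set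
  StableFrom π ℓ = ∀ i → ℓ ≤ i → π i ≡ π ℓ

  IsLen : (ℕ → Carrier) → ℕ → Set
  IsLen π ℓ = StableFrom π ℓ × (∀ k → StableFrom π k → ℓ ≤ k)

  record BPath : Set₁ where
    field
      path   : ℕ → Carrier
      isPath : IsPath path
      len    : ℕ
      isLen  : IsLen path len
    first : Carrier
    first = path 0
    last : Carrier
    last = path len

  open BPath public

  BPathsF : Carrier → BPath → Set
  BPathsF x π = first π ≡ x

  BPathsT : Carrier → BPath → Set
  BPathsT x π = last π ≡ x

  Tr : BPath → ℕ → Subset AP
  Tr π i = V⁻¹ (path π i)

  _≈Tr_ : (ℕ → Subset AP) → (ℕ → Subset AP) → Set
  t₁ ≈Tr t₂ = ∀ i → t₁ i ≐ t₂ i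

  SameTraces : (BPath → Set) → (BPath → Set) → Set₁
  SameTraces P₁ P₂ =
    (∀ π₁ → P₁ π₁ → Σ BPath λ π₂ → P₂ π₂ × (Tr π₁ ≈Tr Tr π₂)) ×
    (∀ π₂ → P₂ π₂ → Σ BPath λ π₁ → P₁ π₁ × (Tr π₁ ≈Tr Tr π₂))

  TraceEquivalent : Carrier → Carrier → Set₁
  TraceEquivalent x₁ x₂ =
    SameTraces (BPathsF x₁) (BPathsF x₂) × SameTraces (BPathsT x₁) (BPathsT x₂)

  record IsPathBisimulation (B : Carrier → Carrier → Set) : Set₁ where
    field
      nonEmpty : Σ Carrier λ a → Σ Carrier λ b → B a b
      atoms    : ∀ x₁ x₂ → B x₁ x₂ → V⁻¹ x₁ ≐ V⁻¹ x₂
      fwd₁     : ∀ x₁ x₂ → B x₁ x₂ → ∀ π₁ → BPathsF x₁ π₁ →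
                 Σ BPath λ π₂ → BPathsF x₂ π₂ × B (last π₁) (last π₂)
      fwd₂     : ∀ x₁ x₂ → B x₁ x₂ → ∀ π₂ → BPathsF x₂ π₂ →
                 Σ BPath λ π₁ → BPathsF x₁ π₁ × B (last π₁) (last π₂)
      bwd₁     : ∀ x₁ x₂ → B x₁ x₂ → ∀ π₁ → BPathsT x₁ π₁ →
                 Σ BPath λ π₂ → BPathsT x₂ π₂ × B (first π₁) (first π₂)
      bwd₂     : ∀ x₁ x₂ → B x₁ x₂ → ∀ π₂ → BPathsT x₂ π₂ →
                 Σ BPath λ π₁ → BPathsT x₁ π₁ × B (first π₁) (first π₂)

  PathBisimilar : Carrier → Carrier → Set₁
  PathBisimilar x₁ x₂ =
    Σ (Carrier → Carrier → Set) λ B → IsPathBisimulation B × B x₁ x₂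

{-# OPTIONS --safe #-}
module Submission where

-- In the closure space induced by a binary relation, paths are exactly the
-- sequences whose consecutive points are equal or related, so both notions can be
-- compared on small finite graphs.
--
-- In the graph x1 → m → e, x2 → m, x2 → e (m labelled q, e labelled r), relating
-- x1 with x2 is a Path-bisimulation, because Path-bisimulation only compares the
-- end points of paths and x1, x2 reach the same points up to that identification;
-- but x2 reaches an r-point in one step and x1 does not, so their traces differ.
--
-- In the graph y1 → a, y1 → b → c, y2 → b' → c' (a, b, b' labelled q and c, c'
-- labelled r), label-preserving graph morphisms map each half onto the other, so
-- y1 and y2 have the same traces; but a bisimulation would have to relate the dead
-- end a to b', the only q-point reachable from y2, and then a to c', whose label
-- differs.

open import Level using (0ℓ)
open import Function using (_∘_; id)
open import Data.Empty using (⊥; ⊥-elim)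
open import Data.Unit using (⊤; tt)
open import Data.Maybe using (Maybe; just; nothing)
open import Data.Nat using (ℕ; zero; suc; _≤_; _<?_; z≤n; s≤s)
open import Data.Nat.Properties using (m≤n⇒m<n∨m≡n; ≮⇒≥; ≤-trans; n≤1+n)
import Data.Nat.Properties as ℕ
open import Data.Product using (Σ; ∃; _×_; _,_; proj₁; proj₂)
open import Data.Sum using (_⊎_; inj₁; inj₂)
open import Relation.Nullary using (¬_; yes; no; contradiction)
open import Relation.Nullary.Decidable using (map′)
open import Relation.Binary.Core using (Rel; _=[_]⇒_)
open import Relation.Binary.Definitions using (DecidableEquality)
open import Relation.Binary.PropositionalEquality
open import Relation.Binary.Construct.Closure.Reflexive
  using (ReflClosure; [_]) renaming (refl to stay; reflexive to ≡⇒ReflClosure; map to mapReflClosure)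
open import Relation.Binary.Construct.Closure.ReflexiveTransitive using (Star; ε; _◅_)
open import Defs

≐-refl : {X : Set} {A : Subset X} → A ≐ A
≐-refl = (λ _ p → p) , (λ _ p → p)

≐-sym : {X : Set} {A B : Subset X} → A ≐ B → B ≐ A
≐-sym (A⊆B , B⊆A) = B⊆A , A⊆B

≟-viaRetraction : {X : Set} (code : X → ℕ) (decode : ℕ → X) →
                  (∀ x → decode (code x) ≡ x) → DecidableEquality X
≟-viaRetraction code decode retract x y = map′ code-injective (cong code) (code x ℕ.≟ code y)
  where
  open ≡-Reasoning
  code-injective : code x ≡ code y → x ≡ y
  code-injective eq = begin
    x               ≡⟨ sym (retract x) ⟩
    decode (code x) ≡⟨ cong decode eq ⟩
    decode (code y) ≡⟨ retract y ⟩
    y               ∎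

labelledBy : {AP X : Set} → (X → Maybe AP) → AP → Subset X
labelledBy label p x = label x ≡ just p

sameLabel⇒sameAtoms : {AP X : Set} (label : X → Maybe AP) {x y : X} → label x ≡ label y →
                      (λ p → labelledBy label p x) ≐ (λ p → labelledBy label p y)
sameLabel⇒sameAtoms label eq = (λ _ lx → trans (sym eq) lx) , (λ _ ly → trans eq ly)

module _ {AP : Set} {M : ClosureModel AP} where

  last≡stableValue : (π : BPath M) {ℓ : ℕ} → StableFrom M (path π) ℓ → last π ≡ path π ℓ
  last≡stableValue π stable = sym (proj₁ (isLen π) _ (proj₂ (isLen π) _ stable))

module _ {AP : Set} (M : ClosureModel AP) where
  open ClosureModel M

  ForwardCondition : (Carrier → Carrier → Set) → Set₁
  ForwardCondition B = ∀ x₁ x₂ → B x₁ x₂ → ∀ π₁ → BPathsF M x₁ π₁ →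
                       Σ (BPath M) λ π₂ → BPathsF M x₂ π₂ × B (last π₁) (last π₂)

  BackwardCondition : (Carrier → Carrier → Set) → Set₁
  BackwardCondition B = ∀ x₁ x₂ → B x₁ x₂ → ∀ π₁ → BPathsT M x₁ π₁ →
                        Σ (BPath M) λ π₂ → BPathsT M x₂ π₂ × B (first π₁) (first π₂)

  symmetric⇒isPathBisimulation : {B : Carrier → Carrier → Set} → (∀ {x y} → B x y → B y x) →
    (Σ Carrier λ x → Σ Carrier λ y → B x y) → (∀ x y → B x y → V⁻¹ x ≐ V⁻¹ y) →
    ForwardCondition B → BackwardCondition B → IsPathBisimulation M B
  symmetric⇒isPathBisimulation {B} B-sym nonEmpty atoms forward backward = record
    { nonEmpty = nonEmpty
    ; atoms    = atoms
    ; fwd₁     = forward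
    ; fwd₂     = λ x₁ x₂ B₁₂ π₂ first≡x₂ →
                   let (π₁ , first≡x₁ , B-ends) = forward x₂ x₁ (B-sym B₁₂) π₂ first≡x₂
                   in π₁ , first≡x₁ , B-sym B-ends
    ; bwd₁     = backward
    ; bwd₂     = λ x₁ x₂ B₁₂ π₂ last≡x₂ →
                   let (π₁ , last≡x₁ , B-ends) = backward x₂ x₁ (B-sym B₁₂) π₂ last≡x₂
                   in π₁ , last≡x₁ , B-sym B-ends
    }

module QuasiDiscrete {AP X : Set} (x₀ : X) (_⟶_ : Rel X 0ℓ) (_≟_ : DecidableEquality X)
                     (V : AP → Subset X) where

  closure : Subset X → Subset X
  closure A y = A y ⊎ ∃ λ x → A x × x ⟶ y

  space : ClosureSpace
  space = record
    { Carrier   = X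
    ; inhabited = x₀
    ; C         = closure
    ; C-∅       = (λ { _ (inj₁ ()) ; _ (inj₂ (_ , () , _)) }) , (λ _ ())
    ; C-ext     = λ _ _ → inj₁
    ; C-∪       = λ _ _ →
        (λ { _ (inj₁ (inj₁ x∈A₁)) → inj₁ (inj₁ x∈A₁)
           ; _ (inj₁ (inj₂ x∈A₂)) → inj₂ (inj₁ x∈A₂)
           ; _ (inj₂ (x , inj₁ x∈A₁ , x⟶y)) → inj₁ (inj₂ (x , x∈A₁ , x⟶y))
           ; _ (inj₂ (x , inj₂ x∈A₂ , x⟶y)) → inj₂ (inj₂ (x , x∈A₂ , x⟶y)) })
      , (λ { _ (inj₁ (inj₁ x∈A₁)) → inj₁ (inj₁ x∈A₁)
           ; _ (inj₂ (inj₁ x∈A₂)) → inj₁ (inj₂ x∈A₂)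
           ; _ (inj₁ (inj₂ (x , x∈A₁ , x⟶y))) → inj₂ (x , inj₁ x∈A₁ , x⟶y)
           ; _ (inj₂ (inj₂ (x , x∈A₂ , x⟶y))) → inj₂ (x , inj₂ x∈A₂ , x⟶y) })
    }

  model : ClosureModel AP
  model = record { space = space ; V = V }

  open ClosureModel model public using (V⁻¹)

  Step : Rel X 0ℓ
  Step = ReflClosure _⟶_

  Steps : (ℕ → X) → Set
  Steps π = ∀ n → Step (π n) (π (suc n))

  step⇒closure : {A : Subset X} {x y : X} → A x → Step x y → closure A y
  step⇒closure x∈A stay      = inj₁ x∈A
  step⇒closure x∈A [ x⟶y ] = inj₂ (_ , x∈A , x⟶y)

  steps⇒isPath : {π : ℕ → X} → Steps π → IsPath model π
  steps⇒isPath steps N' _ (n , inj₁ n∈N' , refl)             = inj₁ (n , n∈N' , refl)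
  steps⇒isPath steps N' _ (_ , inj₂ (n , n∈N' , refl) , refl) = step⇒closure (n , n∈N' , refl) (steps n)

  isPath⇒steps : {π : ℕ → X} → IsPath model π → Steps π
  isPath⇒steps {π} isPath n with isPath (_≡ n) (π (suc n)) (suc n , inj₂ (n , refl , refl) , refl)
  ... | inj₁ (_ , refl , πn≡πn+1)            = ≡⇒ReflClosure πn≡πn+1
  ... | inj₂ (_ , (_ , refl , refl) , πn⟶πn+1) = [ πn⟶πn+1 ]

  -- Computing the least stable index is where decidable equality of points is needed.
  stable⇒len : (π : ℕ → X) (ℓ : ℕ) → StableFrom model π ℓ → ∃ (IsLen model π)
  stable⇒len π zero    stable = 0 , stable , λ _ _ → z≤n
  stable⇒len π (suc ℓ) stable with π ℓ ≟ π (suc ℓ)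
  ... | yes πℓ≡πℓ+1 = stable⇒len π ℓ stable-ℓ
    where
    stable-ℓ : StableFrom model π ℓ
    stable-ℓ i ℓ≤i with m≤n⇒m<n∨m≡n ℓ≤i
    ... | inj₁ ℓ<i  = trans (stable i ℓ<i) (sym πℓ≡πℓ+1)
    ... | inj₂ refl = refl
  ... | no πℓ≢πℓ+1 = suc ℓ , stable , least
    where
    least : ∀ k → StableFrom model π k → suc ℓ ≤ k
    least k stable-k with ℓ <? k
    ... | yes ℓ<k = ℓ<k
    ... | no ℓ≮k  = contradiction (trans (stable-k ℓ k≤ℓ) (sym (stable-k (suc ℓ) (≤-trans k≤ℓ (n≤1+n ℓ)))))
                                  πℓ≢πℓ+1
      where k≤ℓ = ≮⇒≥ ℓ≮k

  bpath : (π : ℕ → X) → Steps π → (ℓ : ℕ) → StableFrom model π ℓ → BPath model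
  bpath π steps ℓ stable = record
    { path = π ; isPath = steps⇒isPath steps
    ; len = proj₁ (stable⇒len π ℓ stable) ; isLen = proj₂ (stable⇒len π ℓ stable) }

  Walk : Rel X 0ℓ
  Walk = Star _⟶_

  walkLength : {x y : X} → Walk x y → ℕ
  walkLength ε       = 0
  walkLength (_ ◅ w) = suc (walkLength w)

  at : {x y : X} → Walk x y → ℕ → X
  at {x} ε       _       = x
  at {x} (_ ◅ _) zero    = x
  at     (_ ◅ w) (suc n) = at w n

  at-steps : {x y : X} (w : Walk x y) → Steps (at w)
  at-steps ε                   _       = stay
  at-steps (x⟶y ◅ ε)         zero    = [ x⟶y ]
  at-steps (x⟶y ◅ _ ◅ _)     zero    = [ x⟶y ]
  at-steps (_ ◅ w)             (suc n) = at-steps w n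

  at-stable : {x y : X} (w : Walk x y) → StableFrom model (at w) (walkLength w)
  at-stable ε       _       _          = refl
  at-stable (_ ◅ w) (suc i) (s≤s ℓ≤i) = at-stable w i ℓ≤i

  at-end : {x y : X} (w : Walk x y) → at w (walkLength w) ≡ y
  at-end ε       = refl
  at-end (_ ◅ w) = at-end w

  walkPath : {x y : X} → Walk x y → BPath model
  walkPath w = bpath (at w) (at-steps w) (walkLength w) (at-stable w)

  first-walkPath : {x y : X} (w : Walk x y) → first (walkPath w) ≡ x
  first-walkPath ε       = refl
  first-walkPath (_ ◅ _) = refl

  last-walkPath : {x y : X} (w : Walk x y) → last (walkPath w) ≡ y
  last-walkPath w = trans (last≡stableValue (walkPath w) (at-stable w)) (at-end w)

  stable-mapped : (h : X → X) (π : BPath model) → StableFrom model (h ∘ path π) (len π)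
  stable-mapped h π i len≤i = cong h (proj₁ (isLen π) i len≤i)

  mapBPath : (h : X → X) → _⟶_ =[ h ]⇒ _⟶_ → BPath model → BPath model
  mapBPath h hom π =
    bpath (h ∘ path π) (mapReflClosure hom ∘ isPath⇒steps (isPath π)) (len π) (stable-mapped h π)

  last-mapBPath : (h : X → X) (hom : _⟶_ =[ h ]⇒ _⟶_) (π : BPath model) →
                  last (mapBPath h hom π) ≡ h (last π)
  last-mapBPath h hom π = last≡stableValue (mapBPath h hom π) (stable-mapped h π)

  LabelPreserving : (X → X) → Set
  LabelPreserving h = ∀ x → V⁻¹ x ≐ V⁻¹ (h x)

  _≈Trace_ : BPath model → BPath model → Set
  π ≈Trace π′ = _≈Tr_ model (Tr model π) (Tr model π′)

  module _ (h : X → X) (hom : _⟶_ =[ h ]⇒ _⟶_) (labels : LabelPreserving h) {x y : X} (hx≡y : h x ≡ y) where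

    tracesF-mapped : ∀ π → BPathsF model x π →
                     Σ (BPath model) λ π′ → BPathsF model y π′ × π ≈Trace π′
    tracesF-mapped π first≡x = mapBPath h hom π , trans (cong h first≡x) hx≡y , labels ∘ path π

    tracesT-mapped : ∀ π → BPathsT model x π →
                     Σ (BPath model) λ π′ → BPathsT model y π′ × π ≈Trace π′
    tracesT-mapped π last≡x =
      mapBPath h hom π , trans (last-mapBPath h hom π) (trans (cong h last≡x) hx≡y) , labels ∘ path π

  traceEquivalent-byMorphisms : {x y : X} (h g : X → X) →
    _⟶_ =[ h ]⇒ _⟶_ → _⟶_ =[ g ]⇒ _⟶_ → LabelPreserving h → LabelPreserving g →
    h x ≡ y → g y ≡ x → TraceEquivalent model x y
  traceEquivalent-byMorphisms h g h-hom g-hom h-labels g-labels hx≡y gy≡x =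
      (tracesF-mapped h h-hom h-labels hx≡y , backwards (tracesF-mapped g g-hom g-labels gy≡x))
    , (tracesT-mapped h h-hom h-labels hx≡y , backwards (tracesT-mapped g g-hom g-labels gy≡x))
    where
    backwards : {P Q : BPath model → Set} →
                (∀ π → P π → Σ (BPath model) λ π′ → Q π′ × π ≈Trace π′) →
                ∀ π → P π → Σ (BPath model) λ π′ → Q π′ × π′ ≈Trace π
    backwards transport π Pπ with transport π Pπ
    ... | π′ , Qπ′ , same-trace = π′ , Qπ′ , λ i → ≐-sym (same-trace i)

  invariant : (S : X → Set) → (∀ {x y} → x ⟶ y → S x → S y) →
              (π : BPath model) → S (first π) → ∀ n → S (path π n)
  invariant S closed π S-first zero    = S-first
  invariant S closed π S-first (suc n) = preserved (isPath⇒steps (isPath π) n) (invariant S closed π S-first n)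
    where
    preserved : ∀ {x y} → Step x y → S x → S y
    preserved stay      = id
    preserved [ x⟶y ] = closed x⟶y

  Source Sink : X → Set
  Source z = ∀ {x} → ¬ x ⟶ z
  Sink z = ∀ {y} → ¬ z ⟶ y

  first≡source : {z : X} → Source z → (π : BPath model) → ∀ n → path π n ≡ z → first π ≡ z
  first≡source source π zero    πn≡z = πn≡z
  first≡source source π (suc n) refl = first≡source source π n (into-source (isPath⇒steps (isPath π) n))
    where
    into-source : ∀ {x} → Step x (path π (suc n)) → x ≡ path π (suc n)
    into-source stay      = refl
    into-source [ x⟶z ] = ⊥-elim (source x⟶z)

  last≡sink : {z : X} → Sink z → (π : BPath model) → first π ≡ z → last π ≡ z
  last≡sink {z} sink π first≡z = invariant (_≡ z) out-of-sink π first≡z (len π)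
    where
    out-of-sink : ∀ {x y} → x ⟶ y → x ≡ z → y ≡ z
    out-of-sink x⟶y refl = ⊥-elim (sink x⟶y)

data Atom : Set where
  q r : Atom

module PathBisimilarNotTraceEquivalent where

  data Point : Set where
    x1 x2 m e : Point

  data _⟶_ : Rel Point 0ℓ where
    x1⟶m : x1 ⟶ m
    m⟶e  : m ⟶ e
    x2⟶m : x2 ⟶ m
    x2⟶e : x2 ⟶ e

  label : Point → Maybe Atom
  label m = just q
  label e = just r
  label _ = nothing

  code : Point → ℕ
  code x1 = 0
  code x2 = 1
  code m  = 2
  code e  = 3

  decode : ℕ → Point
  decode 0 = x1
  decode 1 = x2
  decode 2 = m
  decode _ = e

  decode-code : ∀ x → decode (code x) ≡ x
  decode-code x1 = refl
  decode-code x2 = refl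
  decode-code m  = refl
  decode-code e  = refl

  open QuasiDiscrete x1 _⟶_ (≟-viaRetraction code decode decode-code) (labelledBy label) public

  data _∼_ : Point → Point → Set where
    same  : ∀ {x} → x ∼ x
    x1∼x2 : x1 ∼ x2
    x2∼x1 : x2 ∼ x1

  ∼-sym : ∀ {x y} → x ∼ y → y ∼ x
  ∼-sym same  = same
  ∼-sym x1∼x2 = x2∼x1
  ∼-sym x2∼x1 = x1∼x2

  ∼⇒sameAtoms : ∀ x y → x ∼ y → V⁻¹ x ≐ V⁻¹ y
  ∼⇒sameAtoms _ _ same  = ≐-refl
  ∼⇒sameAtoms _ _ x1∼x2 = sameLabel⇒sameAtoms label {x1} {x2} refl
  ∼⇒sameAtoms _ _ x2∼x1 = sameLabel⇒sameAtoms label {x2} {x1} refl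

  matched-by : ∀ {x y z} → Walk x y → z ∼ y → Σ (BPath model) λ π → BPathsF model x π × z ∼ last π
  matched-by w z∼y = walkPath w , first-walkPath w , subst (_ ∼_) (sym (last-walkPath w)) z∼y

  matched-from-x2 : ∀ y → Σ (BPath model) λ π → BPathsF model x2 π × y ∼ last π
  matched-from-x2 x1 = matched-by ε x1∼x2
  matched-from-x2 x2 = matched-by ε same
  matched-from-x2 m  = matched-by (x2⟶m ◅ ε) same
  matched-from-x2 e  = matched-by (x2⟶e ◅ ε) same

  matched-from-x1 : ∀ y → y ≢ x1 → Σ (BPath model) λ π → BPathsF model x1 π × y ∼ last π
  matched-from-x1 x1 y≢x1 = contradiction refl y≢x1
  matched-from-x1 x2 _    = matched-by ε x2∼x1
  matched-from-x1 m  _    = matched-by (x1⟶m ◅ ε) same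
  matched-from-x1 e  _    = matched-by (x1⟶m ◅ m⟶e ◅ ε) same

  x1-source : Source x1
  x1-source ()

  x2-source : Source x2
  x2-source ()

  forward : ForwardCondition model _∼_
  forward _ _ same  π first≡x  = π , first≡x , same
  forward _ _ x1∼x2 π _        = matched-from-x2 (last π)
  forward _ _ x2∼x1 π first≡x2 = matched-from-x1 (last π) last≢x1
    where
    last≢x1 : last π ≢ x1
    last≢x1 last≡x1 with trans (sym first≡x2) (first≡source x1-source π (len π) last≡x1)
    ... | ()

  backward : BackwardCondition model _∼_
  backward _ _ same  π last≡x  = π , last≡x , same
  backward _ _ x1∼x2 π last≡x1 =
    walkPath (ε {x = x2}) , last-walkPath ε , subst (_∼ x2) (sym (first≡source x1-source π (len π) last≡x1)) x1∼x2
  backward _ _ x2∼x1 π last≡x2 =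
    walkPath (ε {x = x1}) , last-walkPath ε , subst (_∼ x1) (sym (first≡source x2-source π (len π) last≡x2)) x2∼x1

  bisimulation : IsPathBisimulation model _∼_
  bisimulation = symmetric⇒isPathBisimulation model ∼-sym (x1 , x2 , x1∼x2) ∼⇒sameAtoms forward backward

  not-r-after-x1 : ∀ {y} → Step x1 y → ¬ labelledBy label r y
  not-r-after-x1 stay       ()
  not-r-after-x1 [ x1⟶m ] ()

  not-traceEquivalent : ¬ TraceEquivalent model x1 x2
  not-traceEquivalent ((_ , from-x2) , _) with from-x2 (walkPath (x2⟶e ◅ ε)) refl
  ... | π , first≡x1 , same-trace =
    not-r-after-x1 (subst (λ x → Step x (path π 1)) first≡x1 (isPath⇒steps (isPath π) 0))
                   (proj₂ (same-trace 1) r refl)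

module TraceEquivalentNotPathBisimilar where

  data Point : Set where
    y1 a b c y2 b' c' : Point

  data _⟶_ : Rel Point 0ℓ where
    y1⟶a  : y1 ⟶ a
    y1⟶b  : y1 ⟶ b
    b⟶c   : b ⟶ c
    y2⟶b' : y2 ⟶ b'
    b'⟶c' : b' ⟶ c'

  label : Point → Maybe Atom
  label a  = just q
  label b  = just q
  label b' = just q
  label c  = just r
  label c' = just r
  label _  = nothing

  code : Point → ℕ
  code y1 = 0
  code a  = 1
  code b  = 2
  code c  = 3
  code y2 = 4
  code b' = 5
  code c' = 6

  decode : ℕ → Point
  decode 0 = y1
  decode 1 = a
  decode 2 = b
  decode 3 = c
  decode 4 = y2
  decode 5 = b'
  decode _ = c'

  decode-code : ∀ x → decode (code x) ≡ x
  decode-code y1 = refl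
  decode-code a  = refl
  decode-code b  = refl
  decode-code c  = refl
  decode-code y2 = refl
  decode-code b' = refl
  decode-code c' = refl

  open QuasiDiscrete y1 _⟶_ (≟-viaRetraction code decode decode-code) (labelledBy label) public

  toRight toLeft : Point → Point
  toRight y1 = y2
  toRight a  = b'
  toRight b  = b'
  toRight c  = c'
  toRight x  = x

  toLeft y2 = y1
  toLeft b' = b
  toLeft c' = c
  toLeft x  = x

  toRight-hom : _⟶_ =[ toRight ]⇒ _⟶_
  toRight-hom y1⟶a  = y2⟶b'
  toRight-hom y1⟶b  = y2⟶b'
  toRight-hom b⟶c   = b'⟶c'
  toRight-hom y2⟶b' = y2⟶b'
  toRight-hom b'⟶c' = b'⟶c'

  toLeft-hom : _⟶_ =[ toLeft ]⇒ _⟶_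
  toLeft-hom y1⟶a  = y1⟶a
  toLeft-hom y1⟶b  = y1⟶b
  toLeft-hom b⟶c   = b⟶c
  toLeft-hom y2⟶b' = y1⟶b
  toLeft-hom b'⟶c' = b⟶c

  toRight-label : ∀ x → label x ≡ label (toRight x)
  toRight-label y1 = refl
  toRight-label a  = refl
  toRight-label b  = refl
  toRight-label c  = refl
  toRight-label y2 = refl
  toRight-label b' = refl
  toRight-label c' = refl

  toLeft-label : ∀ x → label x ≡ label (toLeft x)
  toLeft-label y1 = refl
  toLeft-label a  = refl
  toLeft-label b  = refl
  toLeft-label c  = refl
  toLeft-label y2 = refl
  toLeft-label b' = refl
  toLeft-label c' = refl

  traceEquivalent : TraceEquivalent model y1 y2
  traceEquivalent = traceEquivalent-byMorphisms toRight toLeft toRight-hom toLeft-hom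
    (sameLabel⇒sameAtoms label ∘ toRight-label) (sameLabel⇒sameAtoms label ∘ toLeft-label) refl refl

  RightHalf : Point → Set
  RightHalf y2 = ⊤
  RightHalf b' = ⊤
  RightHalf c' = ⊤
  RightHalf _  = ⊥

  rightHalf-closed : ∀ {x y} → x ⟶ y → RightHalf x → RightHalf y
  rightHalf-closed y2⟶b' _ = tt
  rightHalf-closed b'⟶c' _ = tt

  rightHalf-q : ∀ x → RightHalf x → labelledBy label q x → x ≡ b'
  rightHalf-q b' _ _ = refl

  a-sink : Sink a
  a-sink ()

  module _ {B : Point → Point → Set} (isB : IsPathBisimulation model B) where
    open IsPathBisimulation isB

    y1-y2⇒a-b' : B y1 y2 → B a b'
    y1-y2⇒a-b' B-y1y2 with fwd₁ y1 y2 B-y1y2 (walkPath (y1⟶a ◅ ε)) refl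
    ... | π , first≡y2 , B-ends = subst (B a) last≡b' B-a-last
      where
      B-a-last : B a (last π)
      B-a-last = subst (λ x → B x (last π)) (last-walkPath (y1⟶a ◅ ε)) B-ends
      last≡b' : last π ≡ b'
      last≡b' = rightHalf-q (last π)
        (invariant RightHalf rightHalf-closed π (subst RightHalf (sym first≡y2) tt) (len π))
        (proj₁ (atoms a (last π) B-a-last) q refl)

    a-b'⇒a-c' : B a b' → B a c'
    a-b'⇒a-c' B-ab' with fwd₂ a b' B-ab' (walkPath (b'⟶c' ◅ ε)) refl
    ... | π , first≡a , B-ends = subst₂ B (last≡sink a-sink π first≡a) (last-walkPath (b'⟶c' ◅ ε)) B-ends

  not-pathBisimilar : ¬ PathBisimilar model y1 y2
  not-pathBisimilar (B , isB , B-y1y2)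
    with proj₁ (IsPathBisimulation.atoms isB a c' (a-b'⇒a-c' isB (y1-y2⇒a-b' isB B-y1y2))) q refl
  ... | ()

proposition8 :
    (Σ Set λ AP → Σ (ClosureModel AP) λ M →
       Σ (ClosureModel.Carrier M) λ x₁ → Σ (ClosureModel.Carrier M) λ x₂ →
         PathBisimilar M x₁ x₂ × ¬ TraceEquivalent M x₁ x₂)
    ×
    (Σ Set λ AP → Σ (ClosureModel AP) λ M →
       Σ (ClosureModel.Carrier M) λ x₁ → Σ (ClosureModel.Carrier M) λ x₂ →
         TraceEquivalent M x₁ x₂ × ¬ PathBisimilar M x₁ x₂)
proposition8 =
    (Atom , P.model , P.x1 , P.x2 , (P._∼_ , P.bisimulation , P.x1∼x2) , P.not-traceEquivalent)
  , (Atom , T.model , T.y1 , T.y2 , T.traceEquivalent , T.not-pathBisimilar)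
  where
  module P = PathBisimilarNotTraceEquivalent
  module T = TraceEquivalentNotPathBisimilar
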